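{- Let $k$ be a positive integer and let $p$ be a prime with $p\equiv 3 \pmod 4$. Let $r$ be a non-negative integer such that $p$ divides $4r+3$. Then for all integers $n\geq 0$, $$\bar{B}_{5,2}\left(4p^{k+1}n+4pr+3p\right)\equiv f(p)\cdot \bar{B}_{5,2}\left(4p^{k-1}n+\frac{4r+3}{p}\right) \pmod 4,$$ where $f(p)=-1$ if $p\equiv 3,7 \pmod{20}$ and $f(p)=1$ if $p\equiv 11,19 \pmod{20}$.
   Context: An overpartition of a positive integer $n$ is a partition of $n$ in which the first occurrence of each distinct part may be overlined. For coprime integers $\ell_1,\ell_2>1$, $\bar{B}_{\ell_1,\ell_2}(n)$ denotes the number of overpartitions of $n$ in which no part is divisible by $\ell_1$ or by $\ell_2$, with $\bar{B}_{\ell_1,\ell_2}(0)=1$. -}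

module Defs where

open import Data.Nat using (ℕ; zero; suc; _+_; _*_; _%_; _≡ᵇ_; _<ᵇ_)
open import Data.Bool using (Bool; true; false; _∧_; _∨_; not; if_then_else_)
open import Data.List using (List; []; _∷_; length; filter; map; concatMap; upTo)
open import Data.Product using (_×_; _,_)
open import Data.Integer using (ℤ; +_; -_)
open import Relation.Nullary.Decidable using (yes; no)
open import Data.Bool.Properties using (T?)

-- An overpartition is represented canonically as a list of pairs
-- (part , overlined?) such that the parts are weakly decreasing and,
-- among equal parts, only the first occurrence may be overlined.

admissible : ℕ → ℕ → ℕ → Bool
admissible ℓ₁ ℓ₂ zero = false
admissible ℓ₁ ℓ₂ s@(suc _) = not (divb ℓ₁) ∧ not (divb ℓ₂)
  where
  divb : ℕ → Bool
  divb zero = false                     -- 0 divides only 0, and s ≥ 1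
  divb d@(suc _) = (s % d) ≡ᵇ 0

canonical : List (ℕ × Bool) → Bool
canonical [] = true
canonical (_ ∷ []) = true
canonical ((s , b) ∷ rest@((s' , b') ∷ _)) =
  ((s' <ᵇ s) ∨ ((s ≡ᵇ s') ∧ not b')) ∧ canonical rest

allAdmissible : ℕ → ℕ → List (ℕ × Bool) → Bool
allAdmissible ℓ₁ ℓ₂ [] = true
allAdmissible ℓ₁ ℓ₂ ((s , _) ∷ xs) = admissible ℓ₁ ℓ₂ s ∧ allAdmissible ℓ₁ ℓ₂ xs

partSum : List (ℕ × Bool) → ℕ
partSum [] = 0
partSum ((s , _) ∷ xs) = s + partSum xs

isOverpartition : ℕ → ℕ → ℕ → List (ℕ × Bool) → Bool
isOverpartition ℓ₁ ℓ₂ n xs =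
  canonical xs ∧ allAdmissible ℓ₁ ℓ₂ xs ∧ (partSum xs ≡ᵇ n)

listsUpTo : {A : Set} → ℕ → List A → List (List A)
listsUpTo zero as = [] ∷ []
listsUpTo (suc k) as = [] ∷ concatMap (λ a → map (a ∷_) (listsUpTo k as)) as

entries : ℕ → List (ℕ × Bool)
entries n = concatMap (λ s → (s , false) ∷ (s , true) ∷ []) (upTo (suc n))

-- Every overpartition of n has at most n parts, each ≤ n, so it occurs
-- (exactly once) in listsUpTo n (entries n).  B̄_{ℓ₁,ℓ₂}(n) counts them;
-- B̄(0) = 1 (the empty overpartition).
Bbar : ℕ → ℕ → ℕ → ℕ
Bbar ℓ₁ ℓ₂ n =
  length (filter (λ xs → T? (isOverpartition ℓ₁ ℓ₂ n xs)) (listsUpTo n (entries n)))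

-- f(p) = -1 if p ≡ 3,7 (mod 20), and 1 otherwise (for primes p ≡ 3 (mod 4)
-- "otherwise" means p ≡ 11,19 (mod 20), since p ≡ 15 (mod 20) is impossible).
f : ℕ → ℤ
f p = if ((p % 20) ≡ᵇ 3) ∨ ((p % 20) ≡ᵇ 7) then - (+ 1) else + 1

module Submission where

-- Overlining the largest part is a free choice, so B̄(N) = 2S for N ≥ 1, where
-- S counts the overpartitions whose largest part s is not overlined.  Modulo 2, the ones
-- with another distinct part t ≠ s cancel in pairs (overline t or not), leaving only
-- N = s + ⋯ + s; hence S ≡ d(N) (mod 2), where d(N) is the number of divisors of N
-- divisible by neither ℓ₁ nor ℓ₂.  For a prime p coprime to ℓ₁ and ℓ₂, the divisors of
-- p²B that do not divide B are exchanged in pairs by t ↦ pt or t ↦ t/p, so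
-- d(p²B) ≡ d(B) (mod 2).  Thus B̄(p²B) = 2a and B̄(B) = 2b with a ≡ b (mod 2), and then
-- 2a ∓ 2b ≡ 0 (mod 4) for either sign f(p) = ∓1.  The index identity
-- 4p^(k+1)n + 4pr + 3p = p²(4p^(k-1)n + q) finishes the proof.

open import Algebra.Properties.CommutativeSemigroup using (interchange)
open import Data.Bool using (Bool; true; false; _∧_; _∨_; not; T; if_then_else_)
open import Data.Bool.Properties using (T?; ∧-zeroʳ; ∧-identityʳ)
import Data.Integer as ℤ
import Data.Integer.Divisibility.Signed as ℤ∣
import Data.Integer.Properties as ℤ
import Data.Integer.Tactic.RingSolver as ℤ-Solver
open import Data.List using (List; []; _∷_; length; filter; map; concatMap; applyUpTo; _++_)
open import Data.Nat using (ℕ; zero; suc; _+_; _*_; _∸_; _^_; _%_; _/_; _≤_; _<_; _≡ᵇ_; _<ᵇ_;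
                            z≤n; s≤s; s≤s⁻¹; z<s; s<s; NonZero; >-nonZero; >-nonZero⁻¹; nonTrivial⇒n>1)
open import Data.Nat.Coprimality using (Coprime; prime⇒coprime)
import Data.Nat.Coprimality as Coprime
open import Data.Nat.DivMod using (m≡m%n+[m/n]*n; %-distribˡ-+; m*n%n≡0; m*n/n≡m; m/n≤m; m*[n/m]≡n)
open import Data.Nat.Divisibility using (_∣?_)
open import Data.Nat.Primality using (Prime; prime?; prime[2]; prime⇒nonZero)
open import Data.Nat.Properties
import Data.Nat.Tactic.RingSolver as ℕ-Solver
open import Data.Product using (_×_; _,_; proj₁; proj₂; ∃-syntax)
open import Data.Sum using (_⊎_; inj₁; inj₂)
open import Function using (_∘_)
open import Function.Bundles using (mk⇔)
open import Level using (0ℓ)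
open import Relation.Binary.Bundles using (Setoid)
open import Relation.Binary.Definitions using (tri<; tri≈; tri>)
open import Relation.Binary.PropositionalEquality
import Relation.Binary.Reasoning.Setoid as ≈-Reasoning
open import Relation.Nullary using (¬_; Dec; does; yes; no; contradiction)
open import Relation.Nullary.Decidable using (dec-true; dec-false; does-⇔; toWitness)

open import Defs

toℕ : Bool → ℕ
toℕ false = 0
toℕ true  = 1

≡ᵇ-refl : ∀ n → (n ≡ᵇ n) ≡ true
≡ᵇ-refl zero    = refl
≡ᵇ-refl (suc n) = ≡ᵇ-refl n

≢⇒≡ᵇ-false : ∀ {m n} → m ≢ n → (m ≡ᵇ n) ≡ false
≢⇒≡ᵇ-false {m} {n} m≢n with m ≡ᵇ n in eq
... | false = refl
... | true  = contradiction (≡ᵇ⇒≡ m n (subst T (sym eq) _)) m≢n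

<ᵇ-irrefl : ∀ n → (n <ᵇ n) ≡ false
<ᵇ-irrefl zero    = refl
<ᵇ-irrefl (suc n) = <ᵇ-irrefl n

≡ᵇ-∸ : ∀ m {n} o → 0 < n → (m + n ≡ᵇ o) ≡ (n ≡ᵇ o ∸ m)
≡ᵇ-∸ zero    o       _   = refl
≡ᵇ-∸ (suc m) {suc n} zero    _   = refl
≡ᵇ-∸ (suc m) (suc o) 0<n = ≡ᵇ-∸ m o 0<n

∧-not-≡ᵇ⇒ : ∀ {a m n} → a ∧ not (m ≡ᵇ n) ≡ true → a ≡ true × m ≢ n
∧-not-≡ᵇ⇒ {true} {m} {n} eq with m ≟ n
... | no m≢n   = refl , m≢n
... | yes refl = contradiction (trans (cong not (sym (≡ᵇ-refl m))) eq) λ ()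

toℕ-∧-split : ∀ {P Q : Set} a (p? : Dec P) (q? : Dec Q) → (P → Q) →
              toℕ (a ∧ does q?) ≡ toℕ (a ∧ does p?) + toℕ ((a ∧ does q?) ∧ not (does p?))
toℕ-∧-split false _       _       _   = refl
toℕ-∧-split true  (yes p) (yes _) _   = refl
toℕ-∧-split true  (yes p) (no ¬q) P⇒Q = contradiction (P⇒Q p) ¬q
toℕ-∧-split true  (no _)  (yes _) _   = refl
toℕ-∧-split true  (no _)  (no _)  _   = refl

sumBelow : ℕ → (ℕ → ℕ) → ℕ
sumBelow zero    g = 0
sumBelow (suc n) g = g 0 + sumBelow n (g ∘ suc)

sumBelow-cong : ∀ n {g h} → (∀ t → t < n → g t ≡ h t) → sumBelow n g ≡ sumBelow n h
sumBelow-cong zero    eq = refl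
sumBelow-cong (suc n) eq = cong₂ _+_ (eq 0 z<s) (sumBelow-cong n (λ t t<n → eq (suc t) (s<s t<n)))

sumBelow-+ : ∀ n g h → sumBelow n (λ t → g t + h t) ≡ sumBelow n g + sumBelow n h
sumBelow-+ zero    g h = refl
sumBelow-+ (suc n) g h = trans (cong (λ m → g 0 + h 0 + m) (sumBelow-+ n (g ∘ suc) (h ∘ suc)))
                               (interchange +-commutativeSemigroup (g 0) (h 0) _ _)

sumBelow-snoc : ∀ n g → sumBelow (suc n) g ≡ sumBelow n g + g n
sumBelow-snoc zero    g = +-comm (g 0) 0
sumBelow-snoc (suc n) g = trans (cong (g 0 +_) (sumBelow-snoc n (g ∘ suc))) (sym (+-assoc (g 0) _ _))

sumBelow-vanishing : ∀ n j g → (∀ t → n ≤ t → g t ≡ 0) → sumBelow (n + j) g ≡ sumBelow n g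
sumBelow-vanishing n zero    g g≡0 = cong (λ m → sumBelow m g) (+-identityʳ n)
sumBelow-vanishing n (suc j) g g≡0 = begin
  sumBelow (n + suc j) g          ≡⟨ cong (λ m → sumBelow m g) (+-suc n j) ⟩
  sumBelow (suc (n + j)) g        ≡⟨ sumBelow-snoc (n + j) g ⟩
  sumBelow (n + j) g + g (n + j)  ≡⟨ cong (sumBelow (n + j) g +_) (g≡0 (n + j) (m≤m+n n j)) ⟩
  sumBelow (n + j) g + 0          ≡⟨ +-identityʳ _ ⟩
  sumBelow (n + j) g              ≡⟨ sumBelow-vanishing n j g g≡0 ⟩
  sumBelow n g                    ∎
  where open ≡-Reasoning

sumBelow-zero : ∀ n → sumBelow n (λ _ → 0) ≡ 0
sumBelow-zero zero    = refl
sumBelow-zero (suc n) = sumBelow-zero n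

sumBelow-indicator : ∀ {n b} → b < n → sumBelow n (λ t → toℕ (t ≡ᵇ b)) ≡ 1
sumBelow-indicator {suc n} {zero}  _         = cong suc (sumBelow-zero n)
sumBelow-indicator {suc n} {suc b} (s<s b<n) = sumBelow-indicator b<n

infix 4 _≡₂_

-- A record rather than m % 2 ≡ n % 2, so that Agda can infer m and n.
record _≡₂_ (m n : ℕ) : Set where
  constructor mk≡₂
  field %2-≡ : m % 2 ≡ n % 2

≡⇒≡₂ : ∀ {m n} → m ≡ n → m ≡₂ n
≡⇒≡₂ m≡n = mk≡₂ (cong (_% 2) m≡n)

≡₂-setoid : Setoid 0ℓ 0ℓ
≡₂-setoid = record
  { Carrier       = ℕ
  ; _≈_           = _≡₂_
  ; isEquivalence = record
    { refl  = mk≡₂ refl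
    ; sym   = λ (mk≡₂ e) → mk≡₂ (sym e)
    ; trans = λ (mk≡₂ e) (mk≡₂ e′) → mk≡₂ (trans e e′)
    }
  }

open Setoid ≡₂-setoid using () renaming (sym to ≡₂-sym; trans to ≡₂-trans)

+-cong-≡₂ : ∀ {a a′ b b′} → a ≡₂ a′ → b ≡₂ b′ → a + b ≡₂ a′ + b′
+-cong-≡₂ {a} {a′} {b} {b′} (mk≡₂ a≡a′) (mk≡₂ b≡b′) = mk≡₂ (begin
  (a + b) % 2                  ≡⟨ %-distribˡ-+ a b 2 ⟩
  (a % 2 + b % 2) % 2          ≡⟨ cong₂ (λ x y → (x + y) % 2) a≡a′ b≡b′ ⟩
  (a′ % 2 + b′ % 2) % 2        ≡⟨ %-distribˡ-+ a′ b′ 2 ⟨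
  (a′ + b′) % 2                ∎)
  where open ≡-Reasoning

n+n≡₂0 : ∀ n → n + n ≡₂ 0
n+n≡₂0 n = mk≡₂ (trans (cong (λ m → (n + m) % 2) (sym (*-identityʳ n)))
                       (trans (cong (_% 2) (sym (*-suc n 1))) (m*n%n≡0 n 2)))

sumBelow-≡₂ : ∀ n {g h} → (∀ t → t < n → g t ≡₂ h t) → sumBelow n g ≡₂ sumBelow n h
sumBelow-≡₂ zero    eq = mk≡₂ refl
sumBelow-≡₂ (suc n) eq = +-cong-≡₂ (eq 0 z<s) (sumBelow-≡₂ n (λ t t<n → eq (suc t) (s<s t<n)))

sumBelow-≡₂-single : ∀ n g {s} → s < n → (∀ t → t < n → t ≢ s → g t ≡₂ 0) → sumBelow n g ≡₂ g s
sumBelow-≡₂-single (suc n) g {zero} _ even = begin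
  g 0 + sumBelow n (g ∘ suc)    ≈⟨ +-cong-≡₂ (mk≡₂ refl) (sumBelow-≡₂ n (λ t t<n → even (suc t) (s<s t<n) λ ())) ⟩
  g 0 + sumBelow n (λ _ → 0)    ≡⟨ cong (g 0 +_) (sumBelow-zero n) ⟩
  g 0 + 0                       ≡⟨ +-identityʳ (g 0) ⟩
  g 0                           ∎
  where open ≈-Reasoning ≡₂-setoid
sumBelow-≡₂-single (suc n) g {suc s} (s<s s<n) even =
  +-cong-≡₂ (even 0 z<s λ ()) (sumBelow-≡₂-single n (g ∘ suc) s<n λ t t<n t≢s → even (suc t) (s<s t<n) (t≢s ∘ suc-injective))

count : {A : Set} → (A → Bool) → List A → ℕ
count P []       = 0
count P (x ∷ xs) = toℕ (P x) + count P xs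

module _ {A : Set} where

  length-filter-T? : ∀ (P : A → Bool) xs → length (filter (T? ∘ P) xs) ≡ count P xs
  length-filter-T? P []       = refl
  length-filter-T? P (x ∷ xs) with P x
  ... | true  = cong suc (length-filter-T? P xs)
  ... | false = length-filter-T? P xs

  count-++ : ∀ (P : A → Bool) xs ys → count P (xs ++ ys) ≡ count P xs + count P ys
  count-++ P []       ys = refl
  count-++ P (x ∷ xs) ys = trans (cong (toℕ (P x) +_) (count-++ P xs ys)) (sym (+-assoc (toℕ (P x)) _ _))

  count-map : ∀ {B : Set} (P : B → Bool) (g : A → B) xs → count P (map g xs) ≡ count (P ∘ g) xs
  count-map P g []       = refl
  count-map P g (x ∷ xs) = cong (toℕ (P (g x)) +_) (count-map P g xs)

  count-cong : ∀ {P Q : A → Bool} → (∀ x → P x ≡ Q x) → ∀ xs → count P xs ≡ count Q xs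
  count-cong P≡Q []       = refl
  count-cong P≡Q (x ∷ xs) = cong₂ _+_ (cong toℕ (P≡Q x)) (count-cong P≡Q xs)

  count-none : ∀ {P : A → Bool} → (∀ x → P x ≡ false) → ∀ xs → count P xs ≡ 0
  count-none P≡false []       = refl
  count-none P≡false (x ∷ xs) rewrite P≡false x = count-none P≡false xs

-- Stated for applyUpTo g rather than upTo, so that the induction goes through.
count-prepend-entries : ∀ (P : List (ℕ × Bool) → Bool) L (g : ℕ → ℕ) n →
  count P (concatMap (λ a → map (a ∷_) L) (concatMap (λ s → (s , false) ∷ (s , true) ∷ []) (applyUpTo g n)))
  ≡ sumBelow n (λ t → count (P ∘ ((g t , false) ∷_)) L + count (P ∘ ((g t , true) ∷_)) L)
count-prepend-entries P L g zero    = refl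
count-prepend-entries P L g (suc n) = begin
  count P (map (x ∷_) L ++ map (x̄ ∷_) L ++ rest)
    ≡⟨ count-++ P (map (x ∷_) L) _ ⟩
  count P (map (x ∷_) L) + count P (map (x̄ ∷_) L ++ rest)
    ≡⟨ cong (count P (map (x ∷_) L) +_) (count-++ P (map (x̄ ∷_) L) rest) ⟩
  count P (map (x ∷_) L) + (count P (map (x̄ ∷_) L) + count P rest)
    ≡⟨ sym (+-assoc (count P (map (x ∷_) L)) _ _) ⟩
  count P (map (x ∷_) L) + count P (map (x̄ ∷_) L) + count P rest
    ≡⟨ cong₂ _+_ (cong₂ _+_ (count-map P (x ∷_) L) (count-map P (x̄ ∷_) L)) (count-prepend-entries P L (g ∘ suc) n) ⟩
  _ ∎
  where
  open ≡-Reasoning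
  x x̄ : ℕ × Bool
  x = g 0 , false
  x̄ = g 0 , true
  rest = concatMap (λ a → map (a ∷_) L) (concatMap (λ s → (s , false) ∷ (s , true) ∷ []) (applyUpTo (g ∘ suc) n))

count-listsUpTo-suc : ∀ (P : List (ℕ × Bool) → Bool) k N → let L = listsUpTo k (entries N) in
  count P (listsUpTo (suc k) (entries N))
  ≡ toℕ (P []) + sumBelow (suc N) (λ t → count (P ∘ ((t , false) ∷_)) L + count (P ∘ ((t , true) ∷_)) L)
count-listsUpTo-suc P k N = cong (toℕ (P []) +_) (count-prepend-entries P (listsUpTo k (entries N)) (λ t → t) (suc N))

-- Fixed-point-free involutions

FixedPointFreeInvolution : ℕ → (ℕ → Bool) → (ℕ → ℕ) → Set
FixedPointFreeInvolution n P ι =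
  ∀ t → t < n → P t ≡ true → ι t < n × P (ι t) ≡ true × ι (ι t) ≡ t × ι t ≢ t

module _ {n P ι} (inv : FixedPointFreeInvolution (suc n) P ι) where

  FixedPointFreeInvolution-dropTop : P n ≡ false → FixedPointFreeInvolution n P ι
  FixedPointFreeInvolution-dropTop Pn≡false t t<n Pt with inv t (m<n⇒m<1+n t<n) Pt
  ... | ιt<1+n , Pιt , ιιt≡t , ιt≢t = ≤∧≢⇒< (s≤s⁻¹ ιt<1+n) ιt≢n , Pιt , ιιt≡t , ιt≢t
    where
    ιt≢n : ι t ≢ n
    ιt≢n ιt≡n = contradiction (trans (sym Pιt) (trans (cong P ιt≡n) Pn≡false)) λ ()

  module _ (Pn : P n ≡ true) where

    FixedPointFreeInvolution-partner< : ι n < n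
    FixedPointFreeInvolution-partner< with inv n (n<1+n n) Pn
    ... | ιn<1+n , _ , _ , ιn≢n = ≤∧≢⇒< (s≤s⁻¹ ιn<1+n) ιn≢n

    FixedPointFreeInvolution-dropPair : FixedPointFreeInvolution n (λ t → P t ∧ not (t ≡ᵇ ι n)) ι
    FixedPointFreeInvolution-dropPair t t<n P′t with ∧-not-≡ᵇ⇒ P′t
    ... | Pt , t≢ιn with inv t (m<n⇒m<1+n t<n) Pt
    ... | ιt<1+n , Pιt , ιιt≡t , ιt≢t =
      ≤∧≢⇒< (s≤s⁻¹ ιt<1+n) ιt≢n , cong₂ _∧_ Pιt (cong not (≢⇒≡ᵇ-false ιt≢ιn)) , ιιt≡t , ιt≢t
      where
      ιt≢n : ι t ≢ n
      ιt≢n ιt≡n = t≢ιn (trans (sym ιιt≡t) (cong ι ιt≡n))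
      ιt≢ιn : ι t ≢ ι n
      ιt≢ιn ιt≡ιn with inv n (n<1+n n) Pn
      ... | _ , _ , ιιn≡n , _ = <⇒≢ t<n (trans (sym ιιt≡t) (trans (cong ι ιt≡ιn) ιιn≡n))

toℕ-dropPoint : ∀ {P : ℕ → Bool} {b} → P b ≡ true → ∀ t → toℕ (P t) ≡ toℕ (P t ∧ not (t ≡ᵇ b)) + toℕ (t ≡ᵇ b)
toℕ-dropPoint {P} {b} Pb t with t ≟ b
... | yes refl rewrite ≡ᵇ-refl t | Pb = refl
... | no t≢b rewrite ≢⇒≡ᵇ-false t≢b = sym (trans (+-identityʳ _) (cong toℕ (∧-identityʳ (P t))))

FixedPointFreeInvolution⇒even : ∀ n {P ι} → FixedPointFreeInvolution n P ι → sumBelow n (toℕ ∘ P) ≡₂ 0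
FixedPointFreeInvolution⇒even zero        _   = mk≡₂ refl
FixedPointFreeInvolution⇒even (suc n) {P} {ι} inv with P n in Pn
... | false = begin
  sumBelow (suc n) (toℕ ∘ P)         ≡⟨ sumBelow-snoc n (toℕ ∘ P) ⟩
  sumBelow n (toℕ ∘ P) + toℕ (P n)   ≡⟨ cong (λ b → sumBelow n (toℕ ∘ P) + toℕ b) Pn ⟩
  sumBelow n (toℕ ∘ P) + 0           ≡⟨ +-identityʳ _ ⟩
  sumBelow n (toℕ ∘ P)               ≈⟨ FixedPointFreeInvolution⇒even n (FixedPointFreeInvolution-dropTop inv Pn) ⟩
  0                                  ∎
  where open ≈-Reasoning ≡₂-setoid
... | true = begin
  sumBelow (suc n) (toℕ ∘ P)                            ≡⟨ sumBelow-snoc n (toℕ ∘ P) ⟩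
  sumBelow n (toℕ ∘ P) + toℕ (P n)                      ≡⟨ cong₂ (λ m b → m + toℕ b) (sumBelow-cong n (λ t _ → toℕ-dropPoint Pb t)) Pn ⟩
  sumBelow n (λ t → toℕ (P′ t) + toℕ (t ≡ᵇ b)) + 1      ≡⟨ cong (_+ 1) (sumBelow-+ n (toℕ ∘ P′) (λ t → toℕ (t ≡ᵇ b))) ⟩
  sumBelow n (toℕ ∘ P′) + sumBelow n (λ t → toℕ (t ≡ᵇ b)) + 1
                                                        ≡⟨ cong (λ m → sumBelow n (toℕ ∘ P′) + m + 1) (sumBelow-indicator b<n) ⟩
  sumBelow n (toℕ ∘ P′) + 1 + 1                         ≡⟨ +-assoc (sumBelow n (toℕ ∘ P′)) 1 1 ⟩
  sumBelow n (toℕ ∘ P′) + 2                             ≈⟨ +-cong-≡₂ (mk≡₂ refl) (n+n≡₂0 1) ⟩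
  sumBelow n (toℕ ∘ P′) + 0                             ≡⟨ +-identityʳ _ ⟩
  sumBelow n (toℕ ∘ P′)                                 ≈⟨ FixedPointFreeInvolution⇒even n (FixedPointFreeInvolution-dropPair inv Pn) ⟩
  0                                                     ∎
  where
  open ≈-Reasoning ≡₂-setoid
  b = ι n
  P′ : ℕ → Bool
  P′ t = P t ∧ not (t ≡ᵇ b)
  b<n : b < n
  b<n = FixedPointFreeInvolution-partner< inv Pn
  Pb : P b ≡ true
  Pb = proj₁ (proj₂ (inv n (n<1+n n) Pn))

-- ℕ's _∣_ is opened only inside this module, since the final statement uses ℤ's.
module _ where

  open import Data.Nat.Coprimality using (coprime-divisor)
  open import Data.Nat.Divisibility
  open import Data.Nat.Primality using (prime⇒irreducible; prime⇒nonTrivial)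

  ∣?-small : ∀ {s m} → 0 < m → m ≤ s → does (s ∣? m) ≡ (s ≡ᵇ m)
  ∣?-small {s} {m} m>0 m≤s with m ≟ s
  ... | yes refl = trans (dec-true (s ∣? s) ∣-refl) (sym (≡ᵇ-refl s))
  ... | no m≢s   = trans (dec-false (s ∣? m) (>⇒∤ {{>-nonZero m>0}} (≤∧≢⇒< m≤s m≢s))) (sym (≢⇒≡ᵇ-false (≢-sym m≢s)))

  ∣?-∸ : ∀ {s m} → s ≤ m → does (s ∣? (m ∸ s)) ≡ does (s ∣? m)
  ∣?-∸ {s} {m} s≤m = does-⇔ (mk⇔ (λ s∣m∸s → ∣m∸n∣n⇒∣m s s≤m s∣m∸s ∣-refl)
                                  (λ s∣m → ∣m+n∣m⇒∣n (subst (s ∣_) (sym (m+[n∸m]≡n s≤m)) s∣m) ∣-refl))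
                             (s ∣? (m ∸ s)) (s ∣? m)

  -- The remainder test inside Defs.admissible is definitionally the decision procedure _∣?_.
  admissible-suc : ∀ ℓ₁ ℓ₂ n → admissible ℓ₁ ℓ₂ (suc n) ≡ not (does (ℓ₁ ∣? suc n)) ∧ not (does (ℓ₂ ∣? suc n))
  admissible-suc zero     zero     n = refl
  admissible-suc zero     (suc ℓ₂) n = refl
  admissible-suc (suc ℓ₁) zero     n = refl
  admissible-suc (suc ℓ₁) (suc ℓ₂) n = refl

  module _ (ℓ₁ ℓ₂ : ℕ) where

    private
      adm : ℕ → Bool
      adm = admissible ℓ₁ ℓ₂

    admissible⇒>0 : ∀ {t} → adm t ≡ true → 0 < t
    admissible⇒>0 {suc t} _ = z<s

    admissible⇒∤ : ∀ {t} → adm t ≡ true → ¬ ℓ₁ ∣ t × ¬ ℓ₂ ∣ t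
    admissible⇒∤ {suc t} a with ℓ₁ ∣? suc t | ℓ₂ ∣? suc t | admissible-suc ℓ₁ ℓ₂ t
    ... | no ℓ₁∤t | no ℓ₂∤t | _  = ℓ₁∤t , ℓ₂∤t
    ... | yes _   | _       | eq = contradiction (trans (sym eq) a) λ ()
    ... | no _    | yes _   | eq = contradiction (trans (sym eq) a) λ ()

    ∤⇒admissible : ∀ {t} → 0 < t → ¬ ℓ₁ ∣ t → ¬ ℓ₂ ∣ t → adm t ≡ true
    ∤⇒admissible {suc t} _ ℓ₁∤t ℓ₂∤t =
      trans (admissible-suc ℓ₁ ℓ₂ t) (cong₂ (λ b c → not b ∧ not c) (dec-false (ℓ₁ ∣? suc t) ℓ₁∤t) (dec-false (ℓ₂ ∣? suc t) ℓ₂∤t))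

    admissible-∣ : ∀ {d t} → adm t ≡ true → d ∣ t → adm d ≡ true
    admissible-∣ {zero}  a 0∣t = contradiction (0∣⇒≡0 0∣t) (>⇒≢ (admissible⇒>0 a))
    admissible-∣ {suc d} a d∣t = ∤⇒admissible z<s (λ ℓ₁∣d → ℓ₁∤t (∣-trans ℓ₁∣d d∣t)) (λ ℓ₂∣d → ℓ₂∤t (∣-trans ℓ₂∣d d∣t))
      where
      ℓ₁∤t = proj₁ (admissible⇒∤ a)
      ℓ₂∤t = proj₂ (admissible⇒∤ a)

    admissible-* : ∀ {p t} → 0 < p → Coprime p ℓ₁ → Coprime p ℓ₂ → adm t ≡ true → adm (p * t) ≡ true
    admissible-* {p} {t} p>0 p⊥ℓ₁ p⊥ℓ₂ a = ∤⇒admissible (*-mono-< p>0 (admissible⇒>0 a))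
      (λ ℓ₁∣pt → proj₁ (admissible⇒∤ a) (coprime-divisor (Coprime.sym p⊥ℓ₁) ℓ₁∣pt))
      (λ ℓ₂∣pt → proj₂ (admissible⇒∤ a) (coprime-divisor (Coprime.sym p⊥ℓ₂) ℓ₂∣pt))

    admissibleDivisor : ℕ → ℕ → Bool
    admissibleDivisor N t = adm t ∧ does (t ∣? N)

    admissibleDivisorCount : ℕ → ℕ
    admissibleDivisorCount N = sumBelow (suc N) (toℕ ∘ admissibleDivisor N)

    canonical-overlinedHead : ∀ t ys → canonical ((t , true) ∷ ys) ≡ canonical ((t , false) ∷ ys)
    canonical-overlinedHead t []      = refl
    canonical-overlinedHead t (_ ∷ _) = refl

    isOverpartition-overlinedHead : ∀ m t ys →
      isOverpartition ℓ₁ ℓ₂ m ((t , true) ∷ ys) ≡ isOverpartition ℓ₁ ℓ₂ m ((t , false) ∷ ys)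
    isOverpartition-overlinedHead m t ys rewrite canonical-overlinedHead t ys = refl

    headedBy : ℕ → ℕ → List (ℕ × Bool) → Bool
    headedBy s m xs = isOverpartition ℓ₁ ℓ₂ m ((s , false) ∷ xs)

    headedBy-[] : ∀ s m → adm s ≡ true → headedBy s m [] ≡ (s ≡ᵇ m)
    headedBy-[] s m a rewrite a | +-identityʳ s = refl

    headedBy-inadmissible : ∀ s m xs → adm s ≡ false → headedBy s m xs ≡ false
    headedBy-inadmissible s m xs a rewrite a = ∧-zeroʳ (canonical ((s , false) ∷ xs))

    headedBy-repeat : ∀ s m ys → adm s ≡ true → headedBy s m ((s , false) ∷ ys) ≡ headedBy s (m ∸ s) ys
    headedBy-repeat s m ys a
      rewrite <ᵇ-irrefl s | ≡ᵇ-refl s | a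
            | ≡ᵇ-∸ s m (≤-trans (admissible⇒>0 a) (m≤m+n s (partSum ys))) = refl

    headedBy-repeatOverlined : ∀ s m ys → headedBy s m ((s , true) ∷ ys) ≡ false
    headedBy-repeatOverlined s m ys rewrite <ᵇ-irrefl s | ≡ᵇ-refl s = refl

    headedBy-overline : ∀ {s t} m ys → s ≢ t → headedBy s m ((t , false) ∷ ys) ≡ headedBy s m ((t , true) ∷ ys)
    headedBy-overline {s} {t} m ys s≢t rewrite ≢⇒≡ᵇ-false s≢t | canonical-overlinedHead t ys = refl

    module _ (N : ℕ) where

      countHeadedBy : ℕ → ℕ → ℕ → ℕ
      countHeadedBy k s m = count (headedBy s m) (listsUpTo k (entries N))

      countHeadedBy-zero : ∀ s m → adm s ≡ true → countHeadedBy 0 s m ≡ toℕ (s ≡ᵇ m)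
      countHeadedBy-zero s m a = trans (+-identityʳ _) (cong toℕ (headedBy-[] s m a))

      countHeadedBy-inadmissible : ∀ k s m → adm s ≡ false → countHeadedBy k s m ≡ 0
      countHeadedBy-inadmissible k s m a = count-none (λ xs → headedBy-inadmissible s m xs a) (listsUpTo k (entries N))

      -- A tail starting with a part t ≢ s is counted once with t overlined and once without.
      countHeadedBy-suc : ∀ k s m → adm s ≡ true → s ≤ N →
                          countHeadedBy (suc k) s m ≡₂ toℕ (s ≡ᵇ m) + countHeadedBy k s (m ∸ s)
      countHeadedBy-suc k s m a s≤N = begin
        countHeadedBy (suc k) s m                       ≡⟨ count-listsUpTo-suc (headedBy s m) k N ⟩
        toℕ (headedBy s m []) + sumBelow (suc N) next   ≈⟨ +-cong-≡₂ (≡⇒≡₂ (cong toℕ (headedBy-[] s m a)))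
                                                                     (sumBelow-≡₂-single (suc N) next (s≤s s≤N) others-cancel) ⟩
        toℕ (s ≡ᵇ m) + next s                           ≡⟨ cong (toℕ (s ≡ᵇ m) +_) next-s ⟩
        toℕ (s ≡ᵇ m) + countHeadedBy k s (m ∸ s)        ∎
        where
        open ≈-Reasoning ≡₂-setoid
        L = listsUpTo k (entries N)
        next : ℕ → ℕ
        next t = count (headedBy s m ∘ ((t , false) ∷_)) L + count (headedBy s m ∘ ((t , true) ∷_)) L
        others-cancel : ∀ t → t < suc N → t ≢ s → next t ≡₂ 0
        others-cancel t _ t≢s = begin
          next t                                   ≡⟨ cong (plain +_) (count-cong (λ ys → headedBy-overline m ys (≢-sym t≢s)) L) ⟨
          plain + plain                            ≈⟨ n+n≡₂0 plain ⟩
          0                                        ∎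
          where plain = count (headedBy s m ∘ ((t , false) ∷_)) L
        next-s : next s ≡ countHeadedBy k s (m ∸ s)
        next-s = trans (cong₂ _+_ (count-cong (λ ys → headedBy-repeat s m ys a) L)
                                  (count-none (headedBy-repeatOverlined s m) L))
                       (+-identityʳ _)

      countHeadedBy-emptySum : ∀ k s → adm s ≡ true → s ≤ N → countHeadedBy k s 0 ≡₂ 0
      countHeadedBy-emptySum zero    s@(suc _) a _   = ≡⇒≡₂ (countHeadedBy-zero s 0 a)
      countHeadedBy-emptySum (suc k) s@(suc _) a s≤N = begin
        countHeadedBy (suc k) s 0       ≈⟨ countHeadedBy-suc k s 0 a s≤N ⟩
        countHeadedBy k s 0             ≈⟨ countHeadedBy-emptySum k s a s≤N ⟩
        0                               ∎
        where open ≈-Reasoning ≡₂-setoid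

      countHeadedBy-∣ : ∀ k s m → adm s ≡ true → s ≤ N → 0 < m → m ≤ s * suc k →
                        countHeadedBy k s m ≡₂ toℕ (does (s ∣? m))
      countHeadedBy-∣ zero s m a _ m>0 m≤s*1 = ≡⇒≡₂ (begin
        countHeadedBy 0 s m   ≡⟨ countHeadedBy-zero s m a ⟩
        toℕ (s ≡ᵇ m)          ≡⟨ cong toℕ (∣?-small m>0 (subst (m ≤_) (*-identityʳ s) m≤s*1)) ⟨
        toℕ (does (s ∣? m))   ∎)
        where open ≡-Reasoning
      countHeadedBy-∣ (suc k) s m a s≤N m>0 m≤s*k with m ≤? s
      ... | yes m≤s = begin
        countHeadedBy (suc k) s m                   ≈⟨ countHeadedBy-suc k s m a s≤N ⟩
        toℕ (s ≡ᵇ m) + countHeadedBy k s (m ∸ s)    ≡⟨ cong (λ n → toℕ (s ≡ᵇ m) + countHeadedBy k s n) (m≤n⇒m∸n≡0 m≤s) ⟩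
        toℕ (s ≡ᵇ m) + countHeadedBy k s 0          ≈⟨ +-cong-≡₂ (mk≡₂ refl) (countHeadedBy-emptySum k s a s≤N) ⟩
        toℕ (s ≡ᵇ m) + 0                            ≡⟨ +-identityʳ _ ⟩
        toℕ (s ≡ᵇ m)                                ≡⟨ cong toℕ (∣?-small m>0 m≤s) ⟨
        toℕ (does (s ∣? m))                         ∎
        where open ≈-Reasoning ≡₂-setoid
      ... | no m≰s = begin
        countHeadedBy (suc k) s m                   ≈⟨ countHeadedBy-suc k s m a s≤N ⟩
        toℕ (s ≡ᵇ m) + countHeadedBy k s (m ∸ s)    ≡⟨ cong (λ b → toℕ b + countHeadedBy k s (m ∸ s)) (≢⇒≡ᵇ-false (<⇒≢ s<m)) ⟩
        countHeadedBy k s (m ∸ s)                   ≈⟨ countHeadedBy-∣ k s (m ∸ s) a s≤N (m<n⇒0<n∸m s<m) m∸s≤s*k ⟩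
        toℕ (does (s ∣? (m ∸ s)))                   ≡⟨ cong toℕ (∣?-∸ (<⇒≤ s<m)) ⟩
        toℕ (does (s ∣? m))                         ∎
        where
        open ≈-Reasoning ≡₂-setoid
        s<m = ≰⇒> m≰s
        m∸s≤s*k = m≤n+o⇒m∸n≤o m s (subst (m ≤_) (*-suc s (suc k)) m≤s*k)

    Bbar-halved : ∀ {N} → 0 < N → ∃[ S ] Bbar ℓ₁ ℓ₂ N ≡ S + S × S ≡₂ admissibleDivisorCount N
    Bbar-halved {suc k} _ = S , Bbar≡S+S , sumBelow-≡₂ (suc N) plain≡₂divisor
      where
      N = suc k
      L = listsUpTo k (entries N)
      plain : ℕ → ℕ
      plain t = countHeadedBy N k t N
      -- S counts the overpartitions of N whose largest part is not overlined.
      S = sumBelow (suc N) plain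

      Bbar≡S+S : Bbar ℓ₁ ℓ₂ N ≡ S + S
      Bbar≡S+S = begin
        Bbar ℓ₁ ℓ₂ N
          ≡⟨ length-filter-T? (isOverpartition ℓ₁ ℓ₂ N) (listsUpTo N (entries N)) ⟩
        count (isOverpartition ℓ₁ ℓ₂ N) (listsUpTo N (entries N))
          ≡⟨ count-listsUpTo-suc (isOverpartition ℓ₁ ℓ₂ N) k N ⟩
        sumBelow (suc N) (λ t → plain t + count (isOverpartition ℓ₁ ℓ₂ N ∘ ((t , true) ∷_)) L)
          ≡⟨ sumBelow-cong (suc N) (λ t _ → cong (plain t +_) (count-cong (isOverpartition-overlinedHead N t) L)) ⟩
        sumBelow (suc N) (λ t → plain t + plain t)
          ≡⟨ sumBelow-+ (suc N) plain plain ⟩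
        S + S ∎
        where open ≡-Reasoning

      plain≡₂divisor : ∀ t → t < suc N → plain t ≡₂ toℕ (adm t ∧ does (t ∣? N))
      plain≡₂divisor t t<sN = byAdmissibility (adm t) refl
        where
        byAdmissibility : ∀ b → adm t ≡ b → plain t ≡₂ toℕ (b ∧ does (t ∣? N))
        byAdmissibility false a = ≡⇒≡₂ (countHeadedBy-inadmissible N k t N a)
        byAdmissibility true  a = countHeadedBy-∣ N k t N a (s≤s⁻¹ t<sN) z<s (m≤n*m N t {{>-nonZero (admissible⇒>0 a)}})

    admissibleDivisorNotDividing : ℕ → ℕ → ℕ → Bool
    admissibleDivisorNotDividing X B t = admissibleDivisor X t ∧ not (does (t ∣? B))

    admissibleDivisorNotDividing-intro : ∀ {X B t} → adm t ≡ true → t ∣ X → ¬ t ∣ B →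
                                         admissibleDivisorNotDividing X B t ≡ true
    admissibleDivisorNotDividing-intro {X} {B} {t} a t∣X t∤B
      rewrite a | dec-true (t ∣? X) t∣X | dec-false (t ∣? B) t∤B = refl

    admissibleDivisorNotDividing-elim : ∀ {X B t} → admissibleDivisorNotDividing X B t ≡ true →
                                        adm t ≡ true × t ∣ X × ¬ t ∣ B
    admissibleDivisorNotDividing-elim {X} {B} {t} new with adm t | t ∣? X | t ∣? B
    ... | true  | yes t∣X | no t∤B = refl , t∣X , t∤B
    ... | true  | yes _   | yes _  = contradiction new λ ()
    ... | true  | no _    | _      = contradiction new λ ()
    ... | false | _       | _      = contradiction new λ ()

    admissibleDivisorCount-∣ : ∀ {B X} → 0 < B → 0 < X → B ∣ X →
      admissibleDivisorCount X ≡ admissibleDivisorCount B + sumBelow (suc X) (toℕ ∘ admissibleDivisorNotDividing X B)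
    admissibleDivisorCount-∣ {B} {X} B>0 X>0 B∣X = begin
      sumBelow (suc X) (toℕ ∘ admissibleDivisor X)
        ≡⟨ sumBelow-cong (suc X) (λ t _ → toℕ-∧-split (adm t) (t ∣? B) (t ∣? X) (λ t∣B → ∣-trans t∣B B∣X)) ⟩
      sumBelow (suc X) (λ t → toℕ (admissibleDivisor B t) + toℕ (admissibleDivisorNotDividing X B t))
        ≡⟨ sumBelow-+ (suc X) (toℕ ∘ admissibleDivisor B) (toℕ ∘ admissibleDivisorNotDividing X B) ⟩
      sumBelow (suc X) (toℕ ∘ admissibleDivisor B) + rest
        ≡⟨ cong (λ n → sumBelow n (toℕ ∘ admissibleDivisor B) + rest) (cong suc (m+[n∸m]≡n B≤X)) ⟨
      sumBelow (suc B + (X ∸ B)) (toℕ ∘ admissibleDivisor B) + rest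
        ≡⟨ cong (_+ rest) (sumBelow-vanishing (suc B) (X ∸ B) (toℕ ∘ admissibleDivisor B) beyond-B) ⟩
      admissibleDivisorCount B + rest ∎
      where
      open ≡-Reasoning
      rest = sumBelow (suc X) (toℕ ∘ admissibleDivisorNotDividing X B)
      B≤X : B ≤ X
      B≤X = ∣⇒≤ {{>-nonZero X>0}} B∣X
      beyond-B : ∀ t → suc B ≤ t → toℕ (admissibleDivisor B t) ≡ 0
      beyond-B t B<t = cong toℕ (trans (cong (adm t ∧_) (dec-false (t ∣? B) (>⇒∤ {{>-nonZero B>0}} B<t))) (∧-zeroʳ (adm t)))

    module _ {p B : ℕ} (p-prime : Prime p) (p⊥ℓ₁ : Coprime p ℓ₁) (p⊥ℓ₂ : Coprime p ℓ₂) (B>0 : 0 < B) where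

      private
        instance
          p≢0 : NonZero p
          p≢0 = prime⇒nonZero p-prime
          X≢0 : NonZero (p * (p * B))
          X≢0 = m*n≢0 p (p * B) {{p≢0}} {{m*n≢0 p B {{p≢0}} {{>-nonZero B>0}}}}

        X : ℕ
        X = p * (p * B)

        p>1 : 1 < p
        p>1 = nonTrivial⇒n>1 p {{prime⇒nonTrivial p-prime}}

        <p* : ∀ {t} → 0 < t → t < p * t
        <p* {t} t>0 = subst (t <_) (*-comm t p) (m<m*n t p {{>-nonZero t>0}} p>1)

        ∤p⇒∣B : ∀ {t} → t ∣ X → ¬ p ∣ t → t ∣ B
        ∤p⇒∣B t∣X p∤t = coprime-divisor t⊥p (coprime-divisor t⊥p t∣X)
          where
          t⊥p : Coprime _ p
          t⊥p (d∣t , d∣p) with prime⇒irreducible p-prime d∣p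
          ... | inj₁ d≡1    = d≡1
          ... | inj₂ refl   = contradiction d∣t p∤t

      -- Moves a divisor t of p²B with t ∤ B between the p-adic valuations v_p(B) + 1 and v_p(B) + 2.
      toggle : ℕ → ℕ
      toggle t = if does (p * t ∣? X) then p * t else t / p

      toggle-up : ∀ {t} → p * t ∣ X → toggle t ≡ p * t
      toggle-up {t} pt∣X rewrite dec-true (p * t ∣? X) pt∣X = refl

      toggle-down : ∀ {t} → ¬ p * t ∣ X → toggle t ≡ t / p
      toggle-down {t} pt∤X rewrite dec-false (p * t ∣? X) pt∤X = refl

      toggle-isFixedPointFreeInvolution : FixedPointFreeInvolution (suc X) (admissibleDivisorNotDividing X B) toggle
      toggle-isFixedPointFreeInvolution t _ new with admissibleDivisorNotDividing-elim {X} {B} {t} new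
      ... | a , t∣X , t∤B with p * t ∣? X
      ...   | yes pt∣X =
        s≤s (∣⇒≤ pt∣X) ,
        admissibleDivisorNotDividing-intro (admissible-* (>-nonZero⁻¹ p) p⊥ℓ₁ p⊥ℓ₂ a) pt∣X (λ pt∣B → t∤B (∣-trans (n∣m*n p) pt∣B)) ,
        trans (toggle-down p²t∤X) (trans (cong (_/ p) (*-comm p t)) (m*n/n≡m t p)) ,
        >⇒≢ (<p* (admissible⇒>0 a))
        where
        p²t∤X : ¬ p * (p * t) ∣ X
        p²t∤X p²t∣X = t∤B (*-cancelˡ-∣ p (*-cancelˡ-∣ p p²t∣X))
      ...   | no pt∤X =
        s≤s (≤-trans (m/n≤m t p) (∣⇒≤ t∣X)) ,
        admissibleDivisorNotDividing-intro (admissible-∣ a u∣t) (∣-trans u∣t t∣X) u∤B ,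
        trans (toggle-up pu∣X) pu≡t ,
        <⇒≢ (subst (u <_) pu≡t (<p* (admissible⇒>0 (admissible-∣ a u∣t))))
        where
        p∣t : p ∣ t
        p∣t with p ∣? t
        ... | yes p∣t = p∣t
        ... | no  p∤t = contradiction (∤p⇒∣B t∣X p∤t) t∤B
        u = t / p
        pu≡t : p * u ≡ t
        pu≡t = m*[n/m]≡n p∣t
        u∣t : u ∣ t
        u∣t = subst (u ∣_) pu≡t (n∣m*n p)
        pu∣X : p * u ∣ X
        pu∣X = subst (_∣ X) (sym pu≡t) t∣X
        u∤B : ¬ u ∣ B
        u∤B u∣B = pt∤X (subst (λ v → p * v ∣ X) pu≡t (*-monoʳ-∣ p (*-monoʳ-∣ p u∣B)))

      admissibleDivisorCount-p²* : admissibleDivisorCount (p * (p * B)) ≡₂ admissibleDivisorCount B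
      admissibleDivisorCount-p²* = begin
        admissibleDivisorCount X
          ≡⟨ admissibleDivisorCount-∣ B>0 (>-nonZero⁻¹ X) (∣-trans (n∣m*n p) (n∣m*n p)) ⟩
        admissibleDivisorCount B + sumBelow (suc X) (toℕ ∘ admissibleDivisorNotDividing X B)
          ≈⟨ +-cong-≡₂ (mk≡₂ refl) (FixedPointFreeInvolution⇒even (suc X) toggle-isFixedPointFreeInvolution) ⟩
        admissibleDivisorCount B + 0
          ≡⟨ +-identityʳ _ ⟩
        admissibleDivisorCount B ∎
        where open ≈-Reasoning ≡₂-setoid

-- The congruence modulo 4

distinctPrimes⇒coprime : ∀ {p q} → Prime p → Prime q → p ≢ q → Coprime p q
distinctPrimes⇒coprime {p} {q} p-prime q-prime p≢q with <-cmp p q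
... | tri< p<q _ _ = Coprime.sym (prime⇒coprime q-prime {{prime⇒nonZero p-prime}} p<q)
... | tri≈ _ p≡q _ = contradiction p≡q p≢q
... | tri> _ _ q<p = prime⇒coprime p-prime {{prime⇒nonZero q-prime}} q<p

double-by-parity : ∀ m → m + m ≡ m % 2 * 2 + m / 2 * 4
double-by-parity m = begin
  m + m                                               ≡⟨ cong (λ n → n + n) (m≡m%n+[m/n]*n m 2) ⟩
  (m % 2 + m / 2 * 2) + (m % 2 + m / 2 * 2)           ≡⟨ lemma (m % 2) (m / 2) ⟩
  m % 2 * 2 + m / 2 * 4                               ∎
  where
  open ≡-Reasoning
  lemma : ∀ c x → (c + x * 2) + (c + x * 2) ≡ c * 2 + x * 4
  lemma = ℕ-Solver.solve-∀

open import Data.Nat using (ℕ; _+_; _*_; _^_; _≤_; _∸_; _%_)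
open import Data.Nat.Primality using (Prime)
open import Data.Integer using (ℤ; +_; _-_)
open import Data.Integer.Divisibility using (_∣_)
open import Relation.Binary.PropositionalEquality using (_≡_)

+-double-by-parity : ∀ m → + (m + m) ≡ + (m % 2) ℤ.* + 2 ℤ.+ + (m / 2) ℤ.* + 4
+-double-by-parity m = begin
  + (m + m)                                     ≡⟨ cong +_ (double-by-parity m) ⟩
  + (m % 2 * 2 + m / 2 * 4)                     ≡⟨ ℤ.pos-+ (m % 2 * 2) (m / 2 * 4) ⟩
  + (m % 2 * 2) ℤ.+ + (m / 2 * 4)               ≡⟨ cong₂ ℤ._+_ (ℤ.pos-* (m % 2) 2) (ℤ.pos-* (m / 2) 4) ⟩
  + (m % 2) ℤ.* + 2 ℤ.+ + (m / 2) ℤ.* + 4       ∎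
  where open ≡-Reasoning

4∣double∓double : ∀ {z} a b → z ≡ ℤ.-1ℤ ⊎ z ≡ ℤ.1ℤ → a ≡₂ b → + 4 ∣ + (a + a) - z ℤ.* + (b + b)
4∣double∓double {z} a b z≡±1 (mk≡₂ a%2≡b%2) = ℤ∣.∣⇒∣ᵤ (ℤ∣.divides (quotient z≡±1) (trans expand (identity z≡±1)))
  where
  c = + (a % 2)
  x = + (a / 2)
  y = + (b / 2)
  expand : + (a + a) - z ℤ.* + (b + b) ≡ (c ℤ.* + 2 ℤ.+ x ℤ.* + 4) - z ℤ.* (c ℤ.* + 2 ℤ.+ y ℤ.* + 4)
  expand = cong₂ (λ u v → u - z ℤ.* v) (+-double-by-parity a)
                 (trans (+-double-by-parity b) (cong (λ d → + d ℤ.* + 2 ℤ.+ y ℤ.* + 4) (sym a%2≡b%2)))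
  quotient : z ≡ ℤ.-1ℤ ⊎ z ≡ ℤ.1ℤ → ℤ
  quotient (inj₁ _) = c ℤ.+ x ℤ.+ y
  quotient (inj₂ _) = x - y
  identity : ∀ (z≡±1 : z ≡ ℤ.-1ℤ ⊎ z ≡ ℤ.1ℤ) →
             (c ℤ.* + 2 ℤ.+ x ℤ.* + 4) - z ℤ.* (c ℤ.* + 2 ℤ.+ y ℤ.* + 4) ≡ quotient z≡±1 ℤ.* + 4
  identity (inj₁ refl) = sum-identity c x y
    where
    sum-identity : ∀ c x y → (c ℤ.* + 2 ℤ.+ x ℤ.* + 4) - ℤ.-1ℤ ℤ.* (c ℤ.* + 2 ℤ.+ y ℤ.* + 4) ≡ (c ℤ.+ x ℤ.+ y) ℤ.* + 4
    sum-identity = ℤ-Solver.solve-∀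
  identity (inj₂ refl) = difference-identity c x y
    where
    difference-identity : ∀ c x y → (c ℤ.* + 2 ℤ.+ x ℤ.* + 4) - ℤ.1ℤ ℤ.* (c ℤ.* + 2 ℤ.+ y ℤ.* + 4) ≡ (x - y) ℤ.* + 4
    difference-identity = ℤ-Solver.solve-∀

Bbar-p²*-mod4 : ∀ ℓ₁ ℓ₂ {p B z} → Prime p → Coprime p ℓ₁ → Coprime p ℓ₂ → 0 < B → z ≡ ℤ.-1ℤ ⊎ z ≡ ℤ.1ℤ →
                + 4 ∣ + Bbar ℓ₁ ℓ₂ (p * (p * B)) - z ℤ.* + Bbar ℓ₁ ℓ₂ B
Bbar-p²*-mod4 ℓ₁ ℓ₂ {p} {B} p-prime p⊥ℓ₁ p⊥ℓ₂ B>0 z≡±1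
  with Bbar-halved ℓ₁ ℓ₂ (*-mono-< p>0 (*-mono-< p>0 B>0)) | Bbar-halved ℓ₁ ℓ₂ B>0
  where p>0 = >-nonZero⁻¹ p {{prime⇒nonZero p-prime}}
... | a , Bbar≡a+a , a≡₂d | b , Bbar≡b+b , b≡₂d rewrite Bbar≡a+a | Bbar≡b+b =
  4∣double∓double a b z≡±1
    (≡₂-trans a≡₂d (≡₂-trans (admissibleDivisorCount-p²* ℓ₁ ℓ₂ p-prime p⊥ℓ₁ p⊥ℓ₂ B>0) (≡₂-sym b≡₂d)))

f-unit : ∀ p → f p ≡ ℤ.-1ℤ ⊎ f p ≡ ℤ.1ℤ
f-unit p with (p % 20 ≡ᵇ 3) ∨ (p % 20 ≡ᵇ 7)
... | true  = inj₁ refl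
... | false = inj₂ refl

index-factorisation : ∀ k p r q n → 4 * r + 3 ≡ p * q →
                      4 * p ^ (suc k + 1) * n + 4 * p * r + 3 * p ≡ p * (p * (4 * p ^ k * n + q))
index-factorisation k p r q n 4r+3≡pq = begin
  4 * p ^ (suc k + 1) * n + 4 * p * r + 3 * p      ≡⟨ cong (λ e → 4 * p ^ e * n + 4 * p * r + 3 * p) (+-comm (suc k) 1) ⟩
  4 * p ^ (2 + k) * n + 4 * p * r + 3 * p          ≡⟨ split p (p ^ k) n r ⟩
  p * (p * (4 * p ^ k * n)) + p * (4 * r + 3)      ≡⟨ cong (λ m → p * (p * (4 * p ^ k * n)) + p * m) 4r+3≡pq ⟩
  p * (p * (4 * p ^ k * n)) + p * (p * q)          ≡⟨ merge p (p ^ k) n q ⟩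
  p * (p * (4 * p ^ k * n + q))                    ∎
  where
  open ≡-Reasoning
  split : ∀ p P n r → 4 * (p * (p * P)) * n + 4 * p * r + 3 * p ≡ p * (p * (4 * P * n)) + p * (4 * r + 3)
  split = ℕ-Solver.solve-∀
  merge : ∀ p P n q → p * (p * (4 * P * n)) + p * (p * q) ≡ p * (p * (4 * P * n + q))
  merge = ℕ-Solver.solve-∀

theorem5p4 : (k p r q n : ℕ) → 1 ≤ k → Prime p → p % 4 ≡ 3 →
    4 * r + 3 ≡ p * q →
    (+ 4) ∣ ((+ Bbar 5 2 (4 * p ^ (k + 1) * n + 4 * p * r + 3 * p))
    - f p Data.Integer.* (+ Bbar 5 2 (4 * p ^ (k ∸ 1) * n + q)))
theorem5p4 (suc k) p r q n _ p-prime p%4≡3 4r+3≡pq rewrite index-factorisation k p r q n 4r+3≡pq =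
  Bbar-p²*-mod4 5 2 p-prime (distinctPrimes⇒coprime p-prime prime[5] p≢5) (distinctPrimes⇒coprime p-prime prime[2] p≢2)
                B>0 (f-unit p)
  where
  prime[5] : Prime 5
  prime[5] = toWitness {a? = prime? 5} _
  p≢2 : p ≢ 2
  p≢2 refl = contradiction p%4≡3 λ ()
  p≢5 : p ≢ 5
  p≢5 refl = contradiction p%4≡3 λ ()
  pq>0 : 0 < p * q
  pq>0 = subst (0 <_) 4r+3≡pq (≤-trans (s≤s z≤n) (m≤n+m 3 (4 * r)))
  B>0 : 0 < 4 * p ^ k * n + q
  B>0 = ≤-trans (>-nonZero⁻¹ q {{m*n≢0⇒n≢0 p {{>-nonZero pq>0}}}}) (m≤n+m q _)
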